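{- Let $G$ be a finite simple graph with $\nu(G)\geq 2$. Then either there exists an edge $e$ of $G$ with $\nu(G-e)=\nu(G)-2$, or there exist non-adjacent vertices $u,v$ of $G$ with $\nu(G+uv)=\nu(G)-2$.
   Context: For a finite simple graph $G$ with vertex set $\{v_1,\dots,v_n\}$, the closed neighborhood matrix $N(G)$ is the symmetric $n\times n$ matrix over $\mathbb{Z}_2$ whose $(i,j)$ entry is $1$ if $i=j$ or $v_iv_j$ is an edge, and $0$ otherwise. The nullity is $\nu(G):=\dim_{\mathbb{Z}_2}\ker N(G)$. $G-e$ denotes $G$ with edge $e$ removed; $G+uv$ denotes $G$ with the edge $uv$ added. -}

module Defs where

open import Data.Nat using (ℕ; zero; suc)
open import Data.Bool using (Bool; true; false; _∧_; _∨_; _xor_; not; if_then_else_)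
open import Data.Fin using (Fin; zero; suc)
open import Data.Fin.Properties using (_≟_)
open import Data.Product using (Σ; _×_; _,_)
open import Relation.Binary.PropositionalEquality using (_≡_; _≢_)
open import Relation.Nullary using (¬_; does; yes; no)
open import Relation.Binary.PropositionalEquality using (refl)
open import Data.Bool.Properties using (∧-comm; ∨-comm)
open import Data.Empty using (⊥-elim)

record Graph (n : ℕ) : Set where
  field
    adj   : Fin n → Fin n → Bool
    sym   : ∀ i j → adj i j ≡ adj j i
    irrefl : ∀ i → adj i i ≡ false
open Graph public

-- Vectors and matrices over Z₂ = Bool (xor as +, ∧ as ·).
Vec₂ : ℕ → Set
Vec₂ n = Fin n → Bool

Mat₂ : ℕ → Set
Mat₂ n = Fin n → Fin n → Bool

Σ₂ : ∀ n → (Fin n → Bool) → Bool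
Σ₂ zero    f = false
Σ₂ (suc n) f = f zero xor Σ₂ n (λ i → f (suc i))

N : ∀ {n} → Graph n → Mat₂ n
N G i j = does (i ≟ j) ∨ adj G i j

_·_ : ∀ {n} → Mat₂ n → Vec₂ n → Vec₂ n
(M · x) i = Σ₂ _ (λ j → M i j ∧ x j)

IsZero : ∀ {n} → Vec₂ n → Set
IsZero x = ∀ i → x i ≡ false

InKer : ∀ {n} → Mat₂ n → Vec₂ n → Set
InKer M x = IsZero (M · x)

lincomb : ∀ {n k} → (Fin k → Vec₂ n) → (Fin k → Bool) → Vec₂ n
lincomb {k = k} b c j = Σ₂ k (λ t → c t ∧ b t j)

IsKerBasis : ∀ {n k} → Mat₂ n → (Fin k → Vec₂ n) → Set
IsKerBasis {n} {k} M b =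
  (∀ t → InKer M (b t)) ×
  (∀ (c : Fin k → Bool) → IsZero (lincomb b c) → ∀ t → c t ≡ false) ×
  (∀ (x : Vec₂ n) → InKer M x → Σ (Fin k → Bool) λ c → ∀ j → lincomb b c j ≡ x j)

DimKer : ∀ {n} → Mat₂ n → ℕ → Set
DimKer {n} M k = Σ (Fin k → Vec₂ n) λ b → IsKerBasis M b

Nullity : ∀ {n} → Graph n → ℕ → Set
Nullity G k = DimKer (N G) k

isPair : ∀ {n} → Fin n → Fin n → Fin n → Fin n → Bool
isPair u v i j = (does (i ≟ u) ∧ does (j ≟ v)) ∨ (does (i ≟ v) ∧ does (j ≟ u))

isPair-sym : ∀ {n} (u v i j : Fin n) → isPair u v i j ≡ isPair u v j i
isPair-sym u v i j
  rewrite ∧-comm (does (i ≟ u)) (does (j ≟ v))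
        | ∧-comm (does (i ≟ v)) (does (j ≟ u))
        = ∨-comm (does (j ≟ v) ∧ does (i ≟ u)) (does (j ≟ u) ∧ does (i ≟ v))

isPair-irr : ∀ {n} (u v : Fin n) → u ≢ v → ∀ i → isPair u v i i ≡ false
isPair-irr u v u≢v i with i ≟ u | i ≟ v
... | yes refl | yes refl = ⊥-elim (u≢v refl)
... | yes _ | no _ = refl
... | no _ | yes _ = refl
... | no _ | no _ = refl

setEdge : ∀ {n} → Fin n → Fin n → Bool → (Fin n → Fin n → Bool) → Fin n → Fin n → Bool
setEdge u v b a i j =
  if isPair u v i j then b else a i j

setEdge-sym : ∀ {n} (u v : Fin n) b (G : Graph n) i j →
  setEdge u v b (adj G) i j ≡ setEdge u v b (adj G) j i
setEdge-sym u v b G i j rewrite isPair-sym u v i j | sym G i j = refl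

setEdge-irr : ∀ {n} (u v : Fin n) → u ≢ v → ∀ b (G : Graph n) i →
  setEdge u v b (adj G) i i ≡ false
setEdge-irr u v u≢v b G i rewrite isPair-irr u v u≢v i = irrefl G i

setPair : ∀ {n} → (u v : Fin n) → u ≢ v → Bool → Graph n → Graph n
setPair u v u≢v b G = record
  { adj = setEdge u v b (adj G)
  ; sym = setEdge-sym u v b G
  ; irrefl = setEdge-irr u v u≢v b G }

_─edge_ : ∀ {n} → Graph n → (Σ (Fin n) λ u → Σ (Fin n) λ v → u ≢ v) → Graph n
G ─edge (u , v , u≢v) = setPair u v u≢v false G

_+edge_ : ∀ {n} → Graph n → (Σ (Fin n) λ u → Σ (Fin n) λ v → u ≢ v) → Graph n
G +edge (u , v , u≢v) = setPair u v u≢v true G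

-- Let k ≥ 2 be the dimension of ker N(G). Two rounds of Gaussian elimination on a kernel basis
-- give coordinates u ≠ v and kernel vectors p, q with (p u, p v) = (1, 0) and (q u, q v) = (0, 1),
-- and show that the kernel vectors vanishing at u and v form a subspace of dimension k − 2.
-- Toggling the pair uv adds eᵤeᵥᵀ + eᵥeᵤᵀ to N(G), so the new matrix N′ agrees with N(G) on
-- vectors vanishing at u and v, while N′ q = eᵤ and N′ p = eᵥ. As N′ is symmetric, every
-- x ∈ ker N′ has x u = ⟨N′ q, x⟩ = ⟨q, N′ x⟩ = 0 and likewise x v = 0; hence ker N′ is exactly
-- that (k − 2)-dimensional subspace. Whether uv is an edge decides if the toggle is G − uv or
-- G + uv.

module Submission where

open import Algebra.Bundles using (CommutativeMonoid; CommutativeRing)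
import Algebra.Properties.CommutativeSemigroup as CommSemigroupProperties
open import Data.Bool using (Bool; true; false; _∧_; _∨_; _xor_; not)
open import Data.Bool.Properties
  using (∧-commutativeMonoid; xor-∧-commutativeRing; ∧-comm; ∧-assoc; ∧-zeroʳ; ∧-identityʳ;
         xor-identityʳ; xor-same; xor-comm; xor-is-ok; ∧-distribˡ-xor; ∧-distribʳ-xor; ¬-not)
  renaming (_≟_ to _≟ᵇ_)
open import Data.Fin using (Fin; zero; suc)
open import Data.Fin.Properties using (_≟_; any?)
open import Data.Nat using (ℕ; zero; suc; _≤_; _∸_; s≤s; z≤n)
open import Data.Product using (Σ; _×_; _,_; proj₁; proj₂)
open import Data.Sum using (_⊎_; inj₁; inj₂)
open import Function using (_∘_)
open import Relation.Binary.PropositionalEquality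
open import Relation.Nullary using (does; yes; no)
open import Relation.Nullary.Decidable using (dec-true; dec-false)

open import Defs hiding (sym)

open CommSemigroupProperties (CommutativeMonoid.commutativeSemigroup ∧-commutativeMonoid)
  using () renaming (x∙yz≈z∙yx to ∧-reverse; x∙yz≈z∙xy to ∧-rotate; interchange to ∧-interchange)
open CommSemigroupProperties (CommutativeMonoid.commutativeSemigroup
  (CommutativeRing.+-commutativeMonoid xor-∧-commutativeRing))
  using () renaming (interchange to xor-interchange)

xor≡false⇒≡ : ∀ {a b} → a xor b ≡ false → b ≡ a
xor≡false⇒≡ {true}  {true}  _ = refl
xor≡false⇒≡ {false} {false} _ = refl
xor≡false⇒≡ {true}  {false} ()
xor≡false⇒≡ {false} {true}  ()

not-xor-true : ∀ b → not b xor true ≡ b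
not-xor-true true  = refl
not-xor-true false = refl

Σ₂-cong : ∀ n {f g : Fin n → Bool} → (∀ i → f i ≡ g i) → Σ₂ n f ≡ Σ₂ n g
Σ₂-cong zero    f≗g = refl
Σ₂-cong (suc n) f≗g = cong₂ _xor_ (f≗g zero) (Σ₂-cong n (λ i → f≗g (suc i)))

Σ₂-zero : ∀ n {f : Fin n → Bool} → (∀ i → f i ≡ false) → Σ₂ n f ≡ false
Σ₂-zero zero    f≗0 = refl
Σ₂-zero (suc n) f≗0 rewrite f≗0 zero = Σ₂-zero n (λ i → f≗0 (suc i))

Σ₂-xor : ∀ n (f g : Fin n → Bool) → Σ₂ n (λ i → f i xor g i) ≡ Σ₂ n f xor Σ₂ n g
Σ₂-xor zero    f g = refl
Σ₂-xor (suc n) f g rewrite Σ₂-xor n (λ i → f (suc i)) (λ i → g (suc i)) =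
  xor-interchange (f zero) (g zero) _ _

Σ₂-∧ˡ : ∀ n a (f : Fin n → Bool) → a ∧ Σ₂ n f ≡ Σ₂ n (λ i → a ∧ f i)
Σ₂-∧ˡ zero    a f = ∧-zeroʳ a
Σ₂-∧ˡ (suc n) a f rewrite sym (Σ₂-∧ˡ n a (λ i → f (suc i))) = ∧-distribˡ-xor a (f zero) _

Σ₂-swap : ∀ m n (f : Fin m → Fin n → Bool) →
  Σ₂ m (λ i → Σ₂ n (f i)) ≡ Σ₂ n (λ j → Σ₂ m (λ i → f i j))
Σ₂-swap zero    n f = sym (Σ₂-zero n (λ _ → refl))
Σ₂-swap (suc m) n f rewrite Σ₂-swap m n (λ i → f (suc i)) = sym (Σ₂-xor n (f zero) _)

unit : ∀ {n} → Fin n → Vec₂ n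
unit t i = does (i ≟ t)

Σ₂-unit : ∀ n (t : Fin n) (x : Vec₂ n) → Σ₂ n (λ i → unit t i ∧ x i) ≡ x t
Σ₂-unit (suc n) zero    x rewrite Σ₂-zero n {λ _ → false} (λ _ → refl) = xor-identityʳ (x zero)
Σ₂-unit (suc n) (suc t) x = Σ₂-unit n t (λ i → x (suc i))

_⊙_ : ∀ {n} → Vec₂ n → Vec₂ n → Bool
x ⊙ y = Σ₂ _ (λ i → x i ∧ y i)

Symmetric : ∀ {n} → Mat₂ n → Set
Symmetric M = ∀ i j → M i j ≡ M j i

·-selfAdjoint : ∀ {n} (M : Mat₂ n) → Symmetric M → ∀ x y → (M · x) ⊙ y ≡ x ⊙ (M · y)
·-selfAdjoint {n} M M-sym x y = begin
  Σ₂ n (λ i → Σ₂ n (λ j → M i j ∧ x j) ∧ y i)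
    ≡⟨ Σ₂-cong n (λ i → trans (∧-comm _ (y i)) (Σ₂-∧ˡ n (y i) _)) ⟩
  Σ₂ n (λ i → Σ₂ n (λ j → y i ∧ (M i j ∧ x j)))
    ≡⟨ Σ₂-swap n n _ ⟩
  Σ₂ n (λ j → Σ₂ n (λ i → y i ∧ (M i j ∧ x j)))
    ≡⟨ Σ₂-cong n (λ j → Σ₂-cong n (λ i → reorder (y i) (x j) (M-sym i j))) ⟩
  Σ₂ n (λ j → Σ₂ n (λ i → x j ∧ (M j i ∧ y i)))
    ≡⟨ Σ₂-cong n (λ j → sym (Σ₂-∧ˡ n (x j) _)) ⟩
  Σ₂ n (λ j → x j ∧ Σ₂ n (λ i → M j i ∧ y i))
    ∎
  where
  open ≡-Reasoning
  reorder : ∀ a b {c d} → c ≡ d → a ∧ (c ∧ b) ≡ b ∧ (d ∧ a)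
  reorder a b refl = ∧-reverse a _ b

⊙-zeroʳ : ∀ {n} (x : Vec₂ n) {y : Vec₂ n} → IsZero y → x ⊙ y ≡ false
⊙-zeroʳ {n} x y≗0 = Σ₂-zero n (λ i → trans (cong (x i ∧_) (y≗0 i)) (∧-zeroʳ (x i)))

kernel-vanishesAt : ∀ {n} (M : Mat₂ n) → Symmetric M → ∀ {w t} →
  (∀ i → (M · w) i ≡ unit t i) → ∀ {x} → InKer M x → x t ≡ false
kernel-vanishesAt {n} M M-sym {w} {t} Mw≗eₜ {x} Mx≗0 = begin
  x t                ≡⟨ sym (Σ₂-unit n t x) ⟩
  unit t ⊙ x         ≡⟨ Σ₂-cong n (λ i → cong (_∧ x i) (sym (Mw≗eₜ i))) ⟩
  (M · w) ⊙ x        ≡⟨ ·-selfAdjoint M M-sym w x ⟩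
  w ⊙ (M · x)        ≡⟨ ⊙-zeroʳ w Mx≗0 ⟩
  false              ∎
  where open ≡-Reasoning

record IsSubspace {n} (P : Vec₂ n → Set) : Set where
  field
    ≗-closed   : ∀ {x y} → (∀ j → x j ≡ y j) → P x → P y
    xor-closed : ∀ {x y} → P x → P y → P (λ j → x j xor y j)

  addMultiple-closed : ∀ {x y} a → P x → P y → P (λ j → x j xor (a ∧ y j))
  addMultiple-closed true  Px Py = xor-closed Px Py
  addMultiple-closed false Px Py = ≗-closed (λ j → sym (xor-identityʳ _)) Px

InKer-isSubspace : ∀ {n} (M : Mat₂ n) → IsSubspace (InKer M)
InKer-isSubspace {n} M = record
  { ≗-closed   = λ x≗y Mx≗0 i → trans (Σ₂-cong n (λ j → cong (M i j ∧_) (sym (x≗y j)))) (Mx≗0 i)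
  ; xor-closed = λ {x} {y} Mx≗0 My≗0 i → begin
      Σ₂ n (λ j → M i j ∧ (x j xor y j))
        ≡⟨ Σ₂-cong n (λ j → ∧-distribˡ-xor (M i j) (x j) (y j)) ⟩
      Σ₂ n (λ j → (M i j ∧ x j) xor (M i j ∧ y j))
        ≡⟨ Σ₂-xor n _ _ ⟩
      (M · x) i xor (M · y) i
        ≡⟨ cong₂ _xor_ (Mx≗0 i) (My≗0 i) ⟩
      false
        ∎
  }
  where open ≡-Reasoning

VanishingAt : ∀ {n} → (Vec₂ n → Set) → Fin n → Vec₂ n → Set
VanishingAt P u x = P x × x u ≡ false

VanishingAt-isSubspace : ∀ {n} {P : Vec₂ n → Set} → IsSubspace P →
  ∀ u → IsSubspace (VanishingAt P u)
VanishingAt-isSubspace P-sub u = record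
  { ≗-closed   = λ x≗y (Px , xu≡0) → ≗-closed x≗y Px , trans (sym (x≗y u)) xu≡0
  ; xor-closed = λ (Px , xu≡0) (Py , yu≡0) → xor-closed Px Py , cong₂ _xor_ xu≡0 yu≡0
  }
  where open IsSubspace P-sub

Basis : ∀ {n k} → (Vec₂ n → Set) → (Fin k → Vec₂ n) → Set
Basis {n} {k} P b =
  (∀ t → P (b t)) ×
  (∀ (c : Fin k → Bool) → IsZero (lincomb b c) → ∀ t → c t ≡ false) ×
  (∀ (x : Vec₂ n) → P x → Σ (Fin k → Bool) λ c → ∀ j → lincomb b c j ≡ x j)

Basis-head-support : ∀ {n m} {P : Vec₂ n → Set} {b : Fin (suc m) → Vec₂ n} →
  Basis P b → Σ (Fin n) λ u → b zero u ≡ true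
Basis-head-support {n} {m} {b = b} (_ , independent , _)
  with any? (λ u → b zero u ≟ᵇ true)
... | yes support = support
... | no  b₀≗0 with independent (unit zero) lincomb≗0 zero
  where
  lincomb≗0 : IsZero (lincomb b (unit zero))
  lincomb≗0 j rewrite Σ₂-zero m {λ _ → false} (λ _ → refl) =
    trans (xor-identityʳ _) (¬-not (λ b₀j≡1 → b₀≗0 (j , b₀j≡1)))
...   | ()

Basis-⇔ : ∀ {n k} {P Q : Vec₂ n → Set} → (∀ {x} → P x → Q x) → (∀ {x} → Q x → P x) →
  {b : Fin k → Vec₂ n} → Basis P b → Basis Q b
Basis-⇔ P⇒Q Q⇒P (b∈P , independent , spans) =
  (λ t → P⇒Q (b∈P t)) , independent , (λ x Qx → spans x (Q⇒P Qx))

-- One step of Gaussian elimination: clearing coordinate u against the pivot b₀.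
module Pivot {n m} {P : Vec₂ n → Set} (P-sub : IsSubspace P)
  {b : Fin (suc m) → Vec₂ n} (b-basis : Basis P b) {u : Fin n} (b₀u≡1 : b zero u ≡ true) where

  reduced : Fin m → Vec₂ n
  reduced t j = b (suc t) j xor (b (suc t) u ∧ b zero j)

  liftCoeffs : (Fin m → Bool) → Fin (suc m) → Bool
  liftCoeffs c zero    = Σ₂ m (λ t → c t ∧ b (suc t) u)
  liftCoeffs c (suc t) = c t

  lincomb-reduced : ∀ c j → lincomb reduced c j ≡ lincomb b (liftCoeffs c) j
  lincomb-reduced c j = begin
    Σ₂ m (λ t → c t ∧ (b (suc t) j xor (b (suc t) u ∧ b zero j)))
      ≡⟨ Σ₂-cong m (λ t → trans (∧-distribˡ-xor (c t) (b (suc t) j) _)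
                                (cong (c t ∧ b (suc t) j xor_) (∧-rotate (c t) _ (b zero j)))) ⟩
    Σ₂ m (λ t → (c t ∧ b (suc t) j) xor (b zero j ∧ (c t ∧ b (suc t) u)))
      ≡⟨ Σ₂-xor m _ _ ⟩
    Σ₂ m (λ t → c t ∧ b (suc t) j) xor Σ₂ m (λ t → b zero j ∧ (c t ∧ b (suc t) u))
      ≡⟨ cong (Σ₂ m (λ t → c t ∧ b (suc t) j) xor_) (sym (Σ₂-∧ˡ m (b zero j) _)) ⟩
    Σ₂ m (λ t → c t ∧ b (suc t) j) xor (b zero j ∧ liftCoeffs c zero)
      ≡⟨ trans (xor-comm _ (b zero j ∧ liftCoeffs c zero))
               (cong (_xor Σ₂ m (λ t → c t ∧ b (suc t) j)) (∧-comm (b zero j) _)) ⟩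
    (liftCoeffs c zero ∧ b zero j) xor Σ₂ m (λ t → c t ∧ b (suc t) j)
      ∎
    where open ≡-Reasoning

  reduced∈VanishingAt : ∀ t → VanishingAt P u (reduced t)
  reduced∈VanishingAt t =
    IsSubspace.addMultiple-closed P-sub a (proj₁ b-basis (suc t)) (proj₁ b-basis zero) ,
    (begin
      a xor (a ∧ b zero u) ≡⟨ cong (λ b₀u → a xor (a ∧ b₀u)) b₀u≡1 ⟩
      a xor (a ∧ true)     ≡⟨ cong (a xor_) (∧-identityʳ a) ⟩
      a xor a              ≡⟨ xor-same a ⟩
      false                ∎)
    where
    open ≡-Reasoning
    a = b (suc t) u

  reduced-independent : ∀ c → IsZero (lincomb reduced c) → ∀ t → c t ≡ false
  reduced-independent c lincomb≗0 t =
    proj₁ (proj₂ b-basis) (liftCoeffs c)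
      (λ j → trans (sym (lincomb-reduced c j)) (lincomb≗0 j)) (suc t)

  reduced-spans : ∀ x → VanishingAt P u x → Σ (Fin m → Bool) λ c → ∀ j → lincomb reduced c j ≡ x j
  reduced-spans x (Px , xu≡0) with proj₂ (proj₂ b-basis) x Px
  ... | c , lincomb≗x = tail , λ j →
    trans (lincomb-reduced tail j)
          (trans (Σ₂-cong (suc m) (λ t → cong (_∧ b t j) (lift-tail t))) (lincomb≗x j))
    where
    tail : Fin m → Bool
    tail t = c (suc t)
    -- The u-coordinate of x = Σ cₜ bₜ vanishes and b₀ u = 1, which pins down c₀.
    lift-tail : ∀ t → liftCoeffs tail t ≡ c t
    lift-tail zero    = xor≡false⇒≡ (begin
      c zero xor s                ≡⟨ cong (_xor s) (sym (∧-identityʳ (c zero))) ⟩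
      (c zero ∧ true) xor s       ≡⟨ cong (λ b₀u → (c zero ∧ b₀u) xor s) (sym b₀u≡1) ⟩
      lincomb b c u               ≡⟨ lincomb≗x u ⟩
      x u                         ≡⟨ xu≡0 ⟩
      false                       ∎)
      where
      open ≡-Reasoning
      s = liftCoeffs tail zero
    lift-tail (suc t) = refl

  reduced-basis : Basis (VanishingAt P u) reduced
  reduced-basis = reduced∈VanishingAt , reduced-independent , reduced-spans

-- The coordinate functionals at u and v are linearly independent on P (witnessed by
-- pickU, pickV) and their common zero set has dimension m.
record IndependentCoordinates {n} (P : Vec₂ n → Set) (m : ℕ) : Set where
  field
    u v        : Fin n
    pickU      : Vec₂ n
    pickU∈P    : P pickU
    pickU-u    : pickU u ≡ true
    pickU-v    : pickU v ≡ false
    pickV      : Vec₂ n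
    pickV∈P    : P pickV
    pickV-u    : pickV u ≡ false
    pickV-v    : pickV v ≡ true
    commonZeros : Fin m → Vec₂ n
    commonZeros-basis : Basis (VanishingAt (VanishingAt P u) v) commonZeros

  u≢v : u ≢ v
  u≢v u≡v with trans (sym pickV-u) (trans (cong pickV u≡v) pickV-v)
  ... | ()

independentCoordinates : ∀ {n m} {P : Vec₂ n → Set} → IsSubspace P →
  ∀ {b : Fin (suc (suc m)) → Vec₂ n} → Basis P b → IndependentCoordinates P m
independentCoordinates {n} {P = P} P-sub {b} b-basis = record
  { u = u ; v = v
  ; pickU = pickU ; pickU∈P = pickU∈P ; pickU-u = pickU-u ; pickU-v = pickU-v
  ; pickV = b′ zero ; pickV∈P = proj₁ b′₀∈P/u ; pickV-u = proj₂ b′₀∈P/u ; pickV-v = b′₀v≡1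
  ; commonZeros = Pivot.reduced Pu-sub b′-basis b′₀v≡1
  ; commonZeros-basis = Pivot.reduced-basis Pu-sub b′-basis b′₀v≡1
  }
  where
  u = proj₁ (Basis-head-support b-basis)
  b₀u≡1 = proj₂ (Basis-head-support b-basis)
  open Pivot P-sub b-basis b₀u≡1 using () renaming (reduced to b′; reduced-basis to b′-basis)
  Pu-sub = VanishingAt-isSubspace P-sub u
  v = proj₁ (Basis-head-support b′-basis)
  b′₀v≡1 = proj₂ (Basis-head-support b′-basis)
  b′₀∈P/u = proj₁ b′-basis zero

  pickU : Vec₂ n
  pickU j = b zero j xor (b zero v ∧ b′ zero j)
  pickU∈P : P pickU
  pickU∈P = IsSubspace.addMultiple-closed P-sub (b zero v) (proj₁ b-basis zero) (proj₁ b′₀∈P/u)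
  pickU-u : pickU u ≡ true
  pickU-u rewrite proj₂ b′₀∈P/u | ∧-zeroʳ (b zero v) = trans (xor-identityʳ _) b₀u≡1
  pickU-v : pickU v ≡ false
  pickU-v rewrite b′₀v≡1 | ∧-identityʳ (b zero v) = xor-same (b zero v)

does-sym : ∀ {n} (i j : Fin n) → does (i ≟ j) ≡ does (j ≟ i)
does-sym i j with i ≟ j
... | yes i≡j = sym (dec-true (j ≟ i) (sym i≡j))
... | no  i≢j = sym (dec-false (j ≟ i) (λ j≡i → i≢j (sym j≡i)))

N-symmetric : ∀ {n} (G : Graph n) → Symmetric (N G)
N-symmetric G i j = cong₂ _∨_ (does-sym i j) (Graph.sym G i j)

unit-disjoint : ∀ {n} {u v : Fin n} → u ≢ v → ∀ j → unit u j ∧ unit v j ≡ false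
unit-disjoint {u = u} {v} u≢v j with j ≟ u
... | yes refl = dec-false (u ≟ v) u≢v
... | no  _    = refl

isPair-true : ∀ {n} {u v i j : Fin n} → isPair u v i j ≡ true → (i ≡ u × j ≡ v) ⊎ (i ≡ v × j ≡ u)
isPair-true {u = u} {v} {i} {j} _ with i ≟ u | j ≟ v | i ≟ v | j ≟ u
... | yes i≡u | yes j≡v | _       | _       = inj₁ (i≡u , j≡v)
... | _       | _       | yes i≡v | yes j≡u = inj₂ (i≡v , j≡u)
isPair-true () | no _  | _    | no _  | _
isPair-true () | no _  | _    | yes _ | no _
isPair-true () | yes _ | no _ | no _  | _
isPair-true () | yes _ | no _ | yes _ | no _

isPair-xor : ∀ {n} {u v : Fin n} → u ≢ v → ∀ j i →
  isPair u v j i ≡ (unit u j ∧ unit v i) xor (unit v j ∧ unit u i)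
isPair-xor {u = u} {v} u≢v j i = ∨≡xor (unit u j ∧ unit v i) (unit v j ∧ unit u i) (begin
  (unit u j ∧ unit v i) ∧ (unit v j ∧ unit u i) ≡⟨ ∧-interchange (unit u j) _ _ _ ⟩
  (unit u j ∧ unit v j) ∧ (unit v i ∧ unit u i) ≡⟨ cong (_∧ _) (unit-disjoint u≢v j) ⟩
  false                                         ∎)
  where
  open ≡-Reasoning
  ∨≡xor : ∀ a b → a ∧ b ≡ false → a ∨ b ≡ a xor b
  ∨≡xor a b a∧b≡0 = sym (begin
    a xor b                  ≡⟨ xor-is-ok a b ⟩
    (a ∨ b) ∧ not (a ∧ b)    ≡⟨ cong (λ c → (a ∨ b) ∧ not c) a∧b≡0 ⟩
    (a ∨ b) ∧ true           ≡⟨ ∧-identityʳ (a ∨ b) ⟩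
    a ∨ b                    ∎)

isPair-· : ∀ {n} {u v : Fin n} → u ≢ v → ∀ x j →
  (isPair u v · x) j ≡ (unit u j ∧ x v) xor (unit v j ∧ x u)
isPair-· {n} {u} {v} u≢v x j = begin
  Σ₂ n (λ i → isPair u v j i ∧ x i)
    ≡⟨ Σ₂-cong n (λ i → trans (cong (_∧ x i) (isPair-xor u≢v j i))
                              (∧-distribʳ-xor (x i) (unit u j ∧ unit v i) (unit v j ∧ unit u i))) ⟩
  Σ₂ n (λ i → ((unit u j ∧ unit v i) ∧ x i) xor ((unit v j ∧ unit u i) ∧ x i))
    ≡⟨ Σ₂-xor n _ _ ⟩
  Σ₂ n (λ i → (unit u j ∧ unit v i) ∧ x i) xor Σ₂ n (λ i → (unit v j ∧ unit u i) ∧ x i)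
    ≡⟨ cong₂ _xor_ (pull (unit u j) v) (pull (unit v j) u) ⟩
  (unit u j ∧ x v) xor (unit v j ∧ x u)
    ∎
  where
  open ≡-Reasoning
  pull : ∀ a t → Σ₂ n (λ i → (a ∧ unit t i) ∧ x i) ≡ a ∧ x t
  pull a t = begin
    Σ₂ n (λ i → (a ∧ unit t i) ∧ x i)  ≡⟨ Σ₂-cong n (λ i → ∧-assoc a (unit t i) (x i)) ⟩
    Σ₂ n (λ i → a ∧ (unit t i ∧ x i))  ≡⟨ sym (Σ₂-∧ˡ n a _) ⟩
    a ∧ Σ₂ n (λ i → unit t i ∧ x i)    ≡⟨ cong (a ∧_) (Σ₂-unit n t x) ⟩
    a ∧ x t                            ∎

module Flip {n} (G : Graph n) {u v : Fin n} (u≢v : u ≢ v) (β : Bool)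
  (uv-flipped : adj G u v ≡ not β) where

  G′ : Graph n
  G′ = setPair u v u≢v β G

  N-flip : ∀ i j → N G′ i j ≡ N G i j xor isPair u v i j
  N-flip i j with isPair u v i j in uv≡ij
  ... | false = sym (xor-identityʳ _)
  ... | true with isPair-true {u = u} {v} {i} {j} uv≡ij
  ...   | inj₁ (refl , refl)
          rewrite dec-false (u ≟ v) u≢v | uv-flipped = sym (not-xor-true β)
  ...   | inj₂ (refl , refl)
          rewrite dec-false (v ≟ u) (u≢v ∘ sym) | Graph.sym G v u | uv-flipped =
            sym (not-xor-true β)

  N-flip-· : ∀ x j → (N G′ · x) j ≡ (N G · x) j xor ((unit u j ∧ x v) xor (unit v j ∧ x u))
  N-flip-· x j = begin
    Σ₂ n (λ i → N G′ j i ∧ x i)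
      ≡⟨ Σ₂-cong n (λ i → cong (_∧ x i) (N-flip j i)) ⟩
    Σ₂ n (λ i → (N G j i xor isPair u v j i) ∧ x i)
      ≡⟨ Σ₂-cong n (λ i → ∧-distribʳ-xor (x i) (N G j i) _) ⟩
    Σ₂ n (λ i → (N G j i ∧ x i) xor (isPair u v j i ∧ x i))
      ≡⟨ Σ₂-xor n _ _ ⟩
    (N G · x) j xor (isPair u v · x) j
      ≡⟨ cong ((N G · x) j xor_) (isPair-· u≢v x j) ⟩
    (N G · x) j xor ((unit u j ∧ x v) xor (unit v j ∧ x u))
      ∎
    where open ≡-Reasoning

  N-flip-·-offPair : ∀ {x} → x u ≡ false → x v ≡ false → ∀ j → (N G′ · x) j ≡ (N G · x) j
  N-flip-·-offPair {x} xu≡0 xv≡0 j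
    rewrite N-flip-· x j | xu≡0 | xv≡0 | ∧-zeroʳ (unit u j) | ∧-zeroʳ (unit v j) = xor-identityʳ _

  N-flip-·-pickV : ∀ {w} → InKer (N G) w → w u ≡ false → w v ≡ true → ∀ j → (N G′ · w) j ≡ unit u j
  N-flip-·-pickV {w} w∈ker wu≡0 wv≡1 j
    rewrite N-flip-· w j | w∈ker j | wu≡0 | wv≡1 | ∧-zeroʳ (unit v j) | ∧-identityʳ (unit u j) =
      xor-identityʳ _

  N-flip-·-pickU : ∀ {w} → InKer (N G) w → w u ≡ true → w v ≡ false → ∀ j → (N G′ · w) j ≡ unit v j
  N-flip-·-pickU {w} w∈ker wu≡1 wv≡0 j
    rewrite N-flip-· w j | w∈ker j | wu≡1 | wv≡0 | ∧-zeroʳ (unit u j) | ∧-identityʳ (unit v j) =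
      refl

nullity-setPair : ∀ {n m} (G : Graph n) (ic : IndependentCoordinates (InKer (N G)) m) →
  let open IndependentCoordinates ic in
  ∀ β → adj G u v ≡ not β → Nullity (setPair u v u≢v β G) m
nullity-setPair G ic β uv-flipped = commonZeros , Basis-⇔ toKer fromKer commonZeros-basis
  where
  open IndependentCoordinates ic
  open Flip G u≢v β uv-flipped

  toKer : ∀ {x} → VanishingAt (VanishingAt (InKer (N G)) u) v x → InKer (N G′) x
  toKer ((x∈ker , xu≡0) , xv≡0) j = trans (N-flip-·-offPair xu≡0 xv≡0 j) (x∈ker j)

  fromKer : ∀ {x} → InKer (N G′) x → VanishingAt (VanishingAt (InKer (N G)) u) v x
  fromKer x∈ker′ = ((λ j → trans (sym (N-flip-·-offPair xu≡0 xv≡0 j)) (x∈ker′ j)) , xu≡0) , xv≡0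
    where
    xu≡0 = kernel-vanishesAt (N G′) (N-symmetric G′) (N-flip-·-pickV pickV∈P pickV-u pickV-v) x∈ker′
    xv≡0 = kernel-vanishesAt (N G′) (N-symmetric G′) (N-flip-·-pickU pickU∈P pickU-u pickU-v) x∈ker′

mainTheorem3 : ∀ {n : ℕ} (G : Graph n) (k : ℕ) → Nullity G k → 2 ≤ k →
    (Σ (Fin n) λ u → Σ (Fin n) λ v → Σ (u ≢ v) λ u≢v →
       adj G u v ≡ true × Nullity (G ─edge (u , v , u≢v)) (k ∸ 2))
    ⊎
    (Σ (Fin n) λ u → Σ (Fin n) λ v → Σ (u ≢ v) λ u≢v →
       adj G u v ≡ false × Nullity (G +edge (u , v , u≢v)) (k ∸ 2))
mainTheorem3 G (suc (suc m)) (_ , b-basis) (s≤s (s≤s z≤n))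
  with independentCoordinates (InKer-isSubspace (N G)) b-basis
... | ic@record { u = u ; v = v } with adj G u v in uv-adjacency
...   | true  = inj₁ (u , v , IndependentCoordinates.u≢v ic , uv-adjacency ,
                      nullity-setPair G ic false uv-adjacency)
...   | false = inj₂ (u , v , IndependentCoordinates.u≢v ic , uv-adjacency ,
                      nullity-setPair G ic true uv-adjacency)
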